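{- Let $a,b,k$ be non-negative integers with $2a+2b-1\le k$. Let $\widetilde{\mathcal{X}}^e_{a,b,k}$ be the set of pairs $(\boldsymbol\lambda,\mathrm{fs}_{ -1}(\boldsymbol\lambda))$ where $\boldsymbol\lambda=(\lambda^{(1)},\dots,\lambda^{(k)})$ is a $k$-tuple of partitions such that, for every $m\in\{1,\dots,k\}$, $\lambda^{(m)}$ has only even parts and each part of $\lambda^{(m)}$ is at least $m+\max\{m-2a,0\}+\max\{m-(k-2b+1),0\}$. Then \[ \sum_{(\boldsymbol\lambda,\mathrm{fs}_{ -1}(\boldsymbol\lambda))\in\widetilde{\mathcal{X}}^e_{a,b,k}}q^{|(\boldsymbol\lambda,\mathrm{fs}_{ -1}(\boldsymbol\lambda))|} =\sum_{s_1\ge\cdots\ge s_k\ge0}\frac{q^{\,s_1^2+\cdots+s_k^2-2\sum_{i=1}^{a}s_{2i}+2\sum_{i=1}^{b}s_{k-2b+2i}}}{(q^2;q^2)_{s_1-s_2}\cdots(q^2;q^2)_{s_{k-1}-s_k}(q^2;q^2)_{s_k}}. \]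
   Context: Partitions are finite (possibly empty) non-increasing sequences of non-negative integers; $|\lambda|$ is the sum of the parts. A generalised frequency sequence is a sequence $(f_i)_{i\in\mathbb Z}$ of non-negative integers with finitely many non-zero terms ($f_i$ = multiplicity of the integer $i$, which may be negative), of weight $|f|=\sum_i if_i$. For a $k$-tuple $\boldsymbol\lambda$ of partitions, let $\ell_m$ be the number of parts of $\lambda^{(m)}$ and $s_m=\ell_m+\cdots+\ell_k$; for $u\in\mathbb Z$, the $u$-frame sequence $\mathrm{fs}_u(\boldsymbol\lambda)$ is the generalised frequency sequence $f$ with $f_{u+2t}=\#\{m: s_m>t\}$ for $0\le t<s_1$ and all other entries $0$ (from index $u$: $s_k$ pairs $(k,0)$, then $s_{k-1}-s_k$ pairs $(k-1,0)$, …, $s_1-s_2$ pairs $(1,0)$). The weight of a pair is $|(\boldsymbol\lambda,f)|=|\lambda^{(1)}|+\cdots+|\lambda^{(k)}|+|f|$. $(a;q)_n=\prod_{t=0}^{n-1}(1-aq^t)$. -}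

module Defs where

open import Data.Bool using (if_then_else_)
open import Data.Nat as ℕ using (ℕ; zero; suc)
open import Data.Nat.DivMod using (_%_)
open import Data.Nat.Divisibility using (_∣_)
open import Data.Integer as ℤ using (ℤ; +_; -[1+_])
open import Data.List as List using (List; []; _∷_; upTo; map; length; filter; concatMap; foldr)
open import Data.List.Relation.Unary.All using (All)
open import Data.List.Relation.Unary.Linked using (Linked)
open import Data.Vec as Vec using (Vec; []; _∷_; lookup)
open import Data.Fin using (Fin; toℕ)
open import Data.Product using (_×_; _,_)

IsPartition : List ℕ → Set
IsPartition = Linked ℕ._≥_

-- 1-based access into a vector, with value 0 outside 1..k
-- (so at s (k+1) = s_{k+1} = 0, and at s 0 = 0).
at : ∀ {k} → Vec ℕ k → ℕ → ℕ
at v zero = 0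
at [] (suc j) = 0
at (x ∷ v) (suc zero) = x
at (x ∷ v) (suc (suc j)) = at v (suc j)

sumℕ : List ℕ → ℕ
sumℕ = foldr ℕ._+_ 0

sumℤ : List ℤ → ℤ
sumℤ = foldr ℤ._+_ (+ 0)

-- s_m = ℓ_m + ... + ℓ_k, as the vector (s_1, ..., s_k)
sVec : ∀ {k} → Vec (List ℕ) k → Vec ℕ k
sVec [] = []
sVec (λ₁ ∷ λs) = (length λ₁ ℕ.+ at (sVec λs) 1) ∷ sVec λs

-- Generalised frequency sequences, represented by a finite list of
-- (index i, multiplicity f_i) pairs; all unlisted entries are 0.

GFS : Set
GFS = List (ℤ × ℕ)

gfsWeight : GFS → ℤ
gfsWeight f = sumℤ (map (λ { (i , m) → i ℤ.* + m }) f)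

-- u-frame sequence: f_{u+2t} = #{m : s_m > t} for 0 ≤ t < s_1.
fs : ∀ {k} → ℤ → Vec (List ℕ) k → GFS
fs u λs = map (λ t → (u ℤ.+ + (2 ℕ.* t) , length (filter (t ℕ.<?_) (Vec.toList s))))
              (upTo (at s 1))
  where s = sVec λs

pairWeight : ∀ {k} → Vec (List ℕ) k → ℤ
pairWeight λs = + sumℕ (map sumℕ (Vec.toList λs)) ℤ.+ gfsWeight (fs -[1+ 0 ] λs)

InX : (a b k : ℕ) → Vec (List ℕ) k → Set
InX a b k λs = (i : Fin k) →
  IsPartition (lookup λs i) ×
  All (λ p → (2 ∣ p) × (bound (suc (toℕ i)) ℕ.≤ p)) (lookup λs i)
  where
  bound : ℕ → ℕ
  bound m = m ℕ.+ (m ℕ.∸ (2 ℕ.* a)) ℕ.+ (m ℕ.∸ ((k ℕ.+ 1) ℕ.∸ (2 ℕ.* b)))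

-- Formal power series in q with integer coefficients.

Series : Set
Series = ℕ → ℤ

one : Series
one n = if n ℕ.≡ᵇ 0 then + 1 else + 0

mul : Series → Series → Series
mul f g n = sumℤ (map (λ i → f i ℤ.* g (n ℕ.∸ i)) (upTo (suc n)))

-- geom j = 1/(1 - q^{2(j+1)}) = Σ_{r ≥ 0} q^{2(j+1) r}
geom : ℕ → Series
geom j n = if (n % (2 ℕ.* suc j)) ℕ.≡ᵇ 0 then + 1 else + 0

invPoch2 : ℕ → Series
invPoch2 zero = one
invPoch2 (suc n) = mul (invPoch2 n) (geom n)

-- coefficient of q^N in q^e · F  (e, N ∈ ℤ)
shiftCoeff : ℤ → Series → ℤ → ℤ
shiftCoeff e F N with N ℤ.- e
... | + n = F n
... | -[1+ _ ] = + 0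

decr : (k B : ℕ) → List (Vec ℕ k)
decr zero B = [] ∷ []
decr (suc k) B = concatMap (λ x → map (x ∷_) (decr k x)) (upTo (suc B))

expo : (a b k : ℕ) → Vec ℕ k → ℤ
expo a b k s =
  (+ sumℕ (map (λ j → at s (suc j) ℕ.* at s (suc j)) (upTo k))
   ℤ.- + (2 ℕ.* sumℕ (map (λ i → at s (2 ℕ.* suc i)) (upTo a))))
   ℤ.+ + (2 ℕ.* sumℕ (map (λ i → at s ((k ℕ.+ 2 ℕ.* suc i) ℕ.∸ (2 ℕ.* b))) (upTo b)))

denom : (k : ℕ) → Vec ℕ k → Series
denom k s = foldr mul one (map (λ j → invPoch2 (at s (suc j) ℕ.∸ at s (suc (suc j)))) (upTo k))

-- coefficient of q^N in the RHS sum truncated to s_1 ≤ B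
rhsTrunc : (a b k B : ℕ) → ℤ → ℤ
rhsTrunc a b k B N = sumℤ (map (λ s → shiftCoeff (expo a b k s) (denom k s) N) (decr k B))

-- Write ℓ_m = s_m - s_{m+1}. The lower bound on the parts of λ^(m) may be rounded up to an
-- even number c_m (this is where 2a + 2b ≤ k + 1 is used), and subtracting c_m from every
-- part identifies λ^(m) with an even partition with exactly ℓ_m parts, zero parts allowed;
-- these are counted by 1/(q²;q²)_{ℓ_m}. The frame sequence contributes ∑_m (s_m² - 2 s_m),
-- and since c_m = 2m - 2 #{i ≤ a : 2i ≤ m} + 2 #{i ≤ b : k - 2b + 2i ≤ m}, summation by
-- parts turns ∑_m ℓ_m c_m - 2 ∑_m s_m into the linear part of the exponent. So the pairs
-- with a fixed shape s_1 ≥ ⋯ ≥ s_k are counted by the corresponding summand. Finally, a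
-- pair of weight N has s_1 ≤ |N| + 1, so every coefficient involves finitely many shapes.

module Submission where

open import Defs
open import Data.Bool using (true; false; if_then_else_; T)
open import Data.Fin using (Fin; toℕ) renaming (zero to fzero; suc to fsuc)
open import Data.Fin.Properties using (toℕ<n)
open import Data.Integer as ℤ using (ℤ; +_; -[1+_])
import Data.Integer.Properties as ℤ
open import Data.Integer.Tactic.RingSolver as ℤ-Solver using ()
open import Data.List
  using (List; []; _∷_; [_]; _++_; _∷ʳ_; length; map; foldr; concatMap; cartesianProductWith;
         filter; upTo; applyUpTo; initLast; _∷ʳ′_)
open import Data.List.Properties
  using (filter-accept; filter-reject; length-map; length-++; map-upTo; map-applyUpTo; map-cong; map-∘;
         map-injective; ∷ʳ-injective)
open import Data.List.Membership.Propositional using (_∈_; find; lose)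
open import Data.List.Membership.Propositional.Properties
  using (∈-map⁺; ∈-map⁻; ∈-concatMap⁺; ∈-concatMap⁻; ∈-upTo⁺; ∈-upTo⁻;
         ∈-cartesianProductWith⁺; ∈-cartesianProductWith⁻)
open import Data.List.Membership.Propositional.Properties.WithK using (unique∧set⇒bag)
open import Data.List.Relation.Binary.BagAndSetEquality using (∼bag⇒↭)
open import Data.List.Relation.Binary.Permutation.Propositional.Properties using (↭-length)
open import Data.List.Relation.Unary.All as All using (All; []; _∷_)
import Data.List.Relation.Unary.All.Properties as All
open import Data.List.Relation.Unary.Any using (here; there)
open import Data.List.Relation.Unary.Linked using ([]; [-]; _∷_)
open import Data.List.Relation.Unary.Unique.Propositional using (Unique; []; _∷_)
import Data.List.Relation.Unary.Unique.Propositional.Properties as Unique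
open import Data.Nat as ℕ using (ℕ; zero; suc; _+_; _*_; _∸_; _≤_; _<_; _≤?_; _<?_; z≤n; s≤s; NonZero)
open import Data.Nat.ListAction.Properties using (sum-++)
open import Data.Nat.DivMod using (_%_; _/_; m*n%n≡0; m*n/n≡m; m≡m%n+[m/n]*n)
open import Data.Nat.Divisibility using (_∣_; divides; ∣m∣n⇒∣m+n; ∣m+n∣m⇒∣n; ∣1⇒≡1)
open import Data.Nat.Properties
open import Data.Nat.Tactic.RingSolver using (solve-∀)
open import Data.Product using (Σ; ∃; ∃-syntax; _×_; _,_; proj₁; proj₂)
open import Data.Sum using (inj₁; inj₂)
open import Data.Unit using (⊤; tt)
open import Data.Vec as Vec using (Vec; []; _∷_; lookup)
import Data.Vec.Properties as Vec
open import Algebra.Properties.Semiring.Sum +-*-semiring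
  using (sum; sum-syntax; sum-cong-≗; sum-replicate-zero; ∑-comm; ∑-distrib-+; *-distribˡ-sum)
open import Function using (_∘_)
open import Function.Bundles using (_⇔_; mk⇔; Equivalence)
import Function.Properties.Equivalence as ⇔
open import Relation.Binary.PropositionalEquality hiding ([_])
open import Relation.Nullary using (yes; no; contradiction)

module _ {A B : Set} where

  Unique-concatMap⁺ : (f : A → List B) {xs : List A} → Unique xs → (∀ x → Unique (f x)) →
    (∀ {x x′ y} → x ∈ xs → x′ ∈ xs → y ∈ f x → y ∈ f x′ → x ≡ x′) →
    Unique (concatMap f xs)
  Unique-concatMap⁺ f {[]} [] _ _ = []
  Unique-concatMap⁺ f {x ∷ xs} (x∉xs ∷ uxs) uf disjoint =
    Unique.++⁺ (uf x) (Unique-concatMap⁺ f uxs uf (λ p q → disjoint (there p) (there q)))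
      λ (y∈fx , y∈rest) → let x′ , x′∈xs , y∈fx′ = find (∈-concatMap⁻ f y∈rest)
                          in All.lookup x∉xs x′∈xs (disjoint (here refl) (there x′∈xs) y∈fx y∈fx′)

  length-concatMap : (f : A → List B) (xs : List A) →
    length (concatMap f xs) ≡ sumℕ (map (length ∘ f) xs)
  length-concatMap f [] = refl
  length-concatMap f (x ∷ xs) = trans (length-++ (f x)) (cong (_+_ (length (f x))) (length-concatMap f xs))

unique-length : {A : Set} {xs ys : List A} → Unique xs → Unique ys →
  (∀ {z} → z ∈ xs ⇔ z ∈ ys) → length xs ≡ length ys
unique-length uxs uys xs⇔ys = ↭-length (∼bag⇒↭ (unique∧set⇒bag uxs uys xs⇔ys))

sumℤ-map-+ : {A : Set} (f : A → ℕ) (xs : List A) → sumℤ (map (+_ ∘ f) xs) ≡ + sumℕ (map f xs)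
sumℤ-map-+ f [] = refl
sumℤ-map-+ f (x ∷ xs) = cong (ℤ._+_ (+ f x)) (sumℤ-map-+ f xs)

sumℤ-map-- : {A : Set} (f g : A → ℕ) (xs : List A) →
  sumℤ (map (λ x → + f x ℤ.- + g x) xs) ≡ + sumℕ (map f xs) ℤ.- + sumℕ (map g xs)
sumℤ-map-- f g [] = refl
sumℤ-map-- f g (x ∷ xs) = trans (cong (ℤ._+_ (+ f x ℤ.- + g x)) (sumℤ-map-- f g xs))
  (interchange (+ f x) (+ g x) (+ sumℕ (map f xs)) (+ sumℕ (map g xs)))
  where
  interchange : ∀ a b c d → (a ℤ.- b) ℤ.+ (c ℤ.- d) ≡ (a ℤ.+ c) ℤ.- (b ℤ.+ d)
  interchange = ℤ-Solver.solve-∀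

𝟙[_≤_] : ℕ → ℕ → ℕ
𝟙[ zero ≤ m ] = 1
𝟙[ suc p ≤ zero ] = 0
𝟙[ suc p ≤ suc m ] = 𝟙[ p ≤ m ]

𝟙-≤ : ∀ {p m} → p ≤ m → 𝟙[ p ≤ m ] ≡ 1
𝟙-≤ z≤n = refl
𝟙-≤ (s≤s p≤m) = 𝟙-≤ p≤m

𝟙-> : ∀ {p m} → m < p → 𝟙[ p ≤ m ] ≡ 0
𝟙-> {suc p} {zero} _ = refl
𝟙-> {suc p} {suc m} (s≤s m<p) = 𝟙-> m<p

sum-map-upTo : (f : ℕ → ℕ) (n : ℕ) → sumℕ (map f (upTo n)) ≡ ∑[ i < n ] f (toℕ i)
sum-map-upTo f n = trans (cong sumℕ (map-upTo f n)) (sum-applyUpTo f n)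
  where
  sum-applyUpTo : ∀ (f : ℕ → ℕ) n → sumℕ (applyUpTo f n) ≡ ∑[ i < n ] f (toℕ i)
  sum-applyUpTo f zero = refl
  sum-applyUpTo f (suc n) = cong (_+_ (f 0)) (sum-applyUpTo (f ∘ suc) n)

sum-map-toList : ∀ {k} (f : ℕ → ℕ) (v : Vec ℕ k) →
  sumℕ (map f (Vec.toList v)) ≡ ∑[ i < k ] f (at v (suc (toℕ i)))
sum-map-toList f [] = refl
sum-map-toList f (x ∷ v) = cong (_+_ (f x)) (sum-map-toList f v)

∑-const : ∀ n c → ∑[ i < n ] c ≡ n * c
∑-const zero c = refl
∑-const (suc n) c = cong (_+_ c) (∑-const n c)

∑-mono-≤ : ∀ {n} {f g : Fin n → ℕ} → (∀ i → f i ≤ g i) → sum f ≤ sum g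
∑-mono-≤ {zero} _ = z≤n
∑-mono-≤ {suc n} f≤g = +-mono-≤ (f≤g fzero) (∑-mono-≤ (f≤g ∘ fsuc))

∑-odd : ∀ v → ∑[ t < v ] (2 * toℕ t + 1) ≡ v * v
∑-odd zero = refl
∑-odd (suc v) = begin
  1 + ∑[ t < v ] (2 * suc (toℕ t) + 1)
    ≡⟨ cong suc (sum-cong-≗ {v} (λ t → shift (toℕ t))) ⟩
  1 + ∑[ t < v ] (2 + (2 * toℕ t + 1))
    ≡⟨ cong suc (∑-distrib-+ {v} (λ _ → 2) (λ t → 2 * toℕ t + 1)) ⟩
  1 + (∑[ t < v ] 2 + ∑[ t < v ] (2 * toℕ t + 1))
    ≡⟨ cong₂ (λ c s → 1 + (c + s)) (∑-const v 2) (∑-odd v) ⟩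
  1 + (v * 2 + v * v)
    ≡⟨ square-suc v ⟩
  suc v * suc v ∎
  where
  open ≡-Reasoning
  shift : ∀ t → 2 * suc t + 1 ≡ 2 + (2 * t + 1)
  shift = solve-∀
  square-suc : ∀ v → 1 + (v * 2 + v * v) ≡ suc v * suc v
  square-suc = solve-∀

∑-columns : ∀ {k} M (g : ℕ → ℕ) (v : Fin k → ℕ) → (∀ i → v i ≤ M) →
  ∑[ t < M ] (g (toℕ t) * ∑[ i < k ] 𝟙[ suc (toℕ t) ≤ v i ]) ≡ ∑[ i < k ] ∑[ t < v i ] g (toℕ t)
∑-columns {k} M g v v≤M = begin
  ∑[ t < M ] (g (toℕ t) * ∑[ i < k ] 𝟙[ suc (toℕ t) ≤ v i ])
    ≡⟨ sum-cong-≗ {M} (λ t → *-distribˡ-sum {k} (g (toℕ t)) _) ⟩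
  ∑[ t < M ] ∑[ i < k ] (g (toℕ t) * 𝟙[ suc (toℕ t) ≤ v i ])
    ≡⟨ ∑-comm {M} {k} _ ⟩
  ∑[ i < k ] ∑[ t < M ] (g (toℕ t) * 𝟙[ suc (toℕ t) ≤ v i ])
    ≡⟨ sum-cong-≗ {k} (λ i → ∑-below M g (v≤M i)) ⟩
  ∑[ i < k ] ∑[ t < v i ] g (toℕ t) ∎
  where
  open ≡-Reasoning
  ∑-below : ∀ M (g : ℕ → ℕ) {w} → w ≤ M →
    ∑[ t < M ] (g (toℕ t) * 𝟙[ suc (toℕ t) ≤ w ]) ≡ ∑[ t < w ] g (toℕ t)
  ∑-below zero g z≤n = refl
  ∑-below (suc M) g z≤n = trans (sum-cong-≗ {suc M} (λ t → *-zeroʳ (g (toℕ t)))) (sum-replicate-zero (suc M))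
  ∑-below (suc M) g (s≤s w≤M) = cong₂ _+_ (*-identityʳ (g 0)) (∑-below M (g ∘ suc) w≤M)

∑-𝟙≤ : ∀ {n} j → j < n → ∑[ i < n ] 𝟙[ toℕ i ≤ j ] ≡ suc j
∑-𝟙≤ {suc n} zero _ = cong suc (sum-replicate-zero n)
∑-𝟙≤ {suc n} (suc j) (s≤s j<n) = cong suc (∑-𝟙≤ j j<n)

-- Enumerations of products of series

module _ {A B C : Set} (f : A → B → C) where

  length-cartesianProductWith : (xs : List A) (ys : List B) →
    length (cartesianProductWith f xs ys) ≡ length xs * length ys
  length-cartesianProductWith [] ys = refl
  length-cartesianProductWith (x ∷ xs) ys = trans (length-++ (map (f x) ys))
    (cong₂ _+_ (length-map (f x) ys) (length-cartesianProductWith xs ys))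

module _ {A : Set} where

  onlyAtZero : A → ℕ → List A
  onlyAtZero a zero = [ a ]
  onlyAtZero a (suc n) = []

  length-onlyAtZero : ∀ a n → one n ≡ + length (onlyAtZero a n)
  length-onlyAtZero a zero = refl
  length-onlyAtZero a (suc n) = refl

  ∈-onlyAtZero⁻ : ∀ {a b n} → b ∈ onlyAtZero a n → n ≡ 0 × b ≡ a
  ∈-onlyAtZero⁻ {n = zero} (here b≡a) = refl , b≡a

  Unique-onlyAtZero : ∀ a n → Unique (onlyAtZero a n)
  Unique-onlyAtZero a zero = [] ∷ []
  Unique-onlyAtZero a (suc n) = []

convolve : {A B C : Set} → (A → B → C) → (ℕ → List A) → (ℕ → List B) → ℕ → List C
convolve _⊕_ E D n = concatMap (λ i → cartesianProductWith _⊕_ (E i) (D (n ∸ i))) (upTo (suc n))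

module _ {A B C : Set} (_⊕_ : A → B → C) (E : ℕ → List A) (D : ℕ → List B) where

  length-convolve : (F G : Series) → (∀ n → F n ≡ + length (E n)) → (∀ n → G n ≡ + length (D n)) →
    ∀ n → mul F G n ≡ + length (convolve _⊕_ E D n)
  length-convolve F G F≡E G≡D n = begin
    sumℤ (map (λ i → F i ℤ.* G (n ∸ i)) (upTo (suc n)))
      ≡⟨ cong sumℤ (map-cong term (upTo (suc n))) ⟩
    sumℤ (map (+_ ∘ block) (upTo (suc n)))
      ≡⟨ sumℤ-map-+ block (upTo (suc n)) ⟩
    + sumℕ (map block (upTo (suc n)))
      ≡⟨ cong +_ (sym (length-concatMap (λ i → cartesianProductWith _⊕_ (E i) (D (n ∸ i))) (upTo (suc n)))) ⟩
    + length (convolve _⊕_ E D n) ∎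
    where
    open ≡-Reasoning
    block : ℕ → ℕ
    block i = length (cartesianProductWith _⊕_ (E i) (D (n ∸ i)))
    term : ∀ i → F i ℤ.* G (n ∸ i) ≡ + block i
    term i = begin
      F i ℤ.* G (n ∸ i)                           ≡⟨ cong₂ ℤ._*_ (F≡E i) (G≡D (n ∸ i)) ⟩
      + length (E i) ℤ.* + length (D (n ∸ i))     ≡⟨ ℤ.pos-* (length (E i)) (length (D (n ∸ i))) ⟨
      + (length (E i) * length (D (n ∸ i)))       ≡⟨ cong +_ (length-cartesianProductWith _⊕_ (E i) _) ⟨
      + block i ∎

  ∈-convolve⁺ : ∀ {n i a b} → i ≤ n → a ∈ E i → b ∈ D (n ∸ i) → a ⊕ b ∈ convolve _⊕_ E D n
  ∈-convolve⁺ i≤n a∈E b∈D =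
    ∈-concatMap⁺ _ (lose (∈-upTo⁺ (s≤s i≤n)) (∈-cartesianProductWith⁺ _⊕_ a∈E b∈D))

  ∈-convolve⁻ : ∀ {n c} → c ∈ convolve _⊕_ E D n →
    ∃[ i ] ∃[ a ] ∃[ b ] (i ≤ n × a ∈ E i × b ∈ D (n ∸ i) × c ≡ a ⊕ b)
  ∈-convolve⁻ {n} c∈ =
    let i , i∈ , c∈block = find (∈-concatMap⁻ _ {xs = upTo (suc n)} c∈)
        a , b , a∈E , b∈D , c≡a⊕b = ∈-cartesianProductWith⁻ _⊕_ (E i) (D (n ∸ i)) c∈block
    in i , a , b , ≤-pred (∈-upTo⁻ i∈) , a∈E , b∈D , c≡a⊕b

  Unique-convolve : (∀ n → Unique (E n)) → (∀ n → Unique (D n)) →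
    (∀ {a a′ b b′} → a ⊕ b ≡ a′ ⊕ b′ → a ≡ a′ × b ≡ b′) →
    (∀ {a i j} → a ∈ E i → a ∈ E j → i ≡ j) →
    ∀ n → Unique (convolve _⊕_ E D n)
  Unique-convolve uE uD ⊕-injective E-graded n =
    Unique-concatMap⁺ _ (Unique.upTo⁺ (suc n))
      (λ i → Unique.cartesianProductWith⁺ _⊕_ ⊕-injective (uE i) (uD (n ∸ i))) disjoint
    where
    disjoint : ∀ {i j c} → i ∈ upTo (suc n) → j ∈ upTo (suc n) →
      c ∈ cartesianProductWith _⊕_ (E i) (D (n ∸ i)) →
      c ∈ cartesianProductWith _⊕_ (E j) (D (n ∸ j)) → i ≡ j
    disjoint {i} {j} _ _ p q
      with a , b , a∈E , _ , refl ← ∈-cartesianProductWith⁻ _⊕_ (E i) (D (n ∸ i)) p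
         | a′ , b′ , a′∈E , _ , c≡ ← ∈-cartesianProductWith⁻ _⊕_ (E j) (D (n ∸ j)) q
      = E-graded a∈E (subst (_∈ E j) (sym (proj₁ (⊕-injective c≡))) a′∈E)

-- Even partitions with a given number of parts

Even : ℕ → Set
Even p = 2 ∣ p

Even-∸ : ∀ {p q} → Even p → Even q → Even (p ∸ q)
Even-∸ (divides p refl) (divides q refl) = divides (p ∸ q) (sym (*-distribʳ-∸ 2 p q))

Even-2* : ∀ r → Even (2 * r)
Even-2* r = divides r (*-comm 2 r)

IsPartition-map : ∀ {f : ℕ → ℕ} {z} → (∀ {p q} → q ≤ p → f q ≤ f p) →
  IsPartition z → IsPartition (map f z)
IsPartition-map f-mono [] = []
IsPartition-map f-mono [-] = [-]
IsPartition-map f-mono (p≥q ∷ z) = f-mono p≥q ∷ IsPartition-map f-mono z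

IsPartition-∷ʳ⁺ : ∀ {x z} → IsPartition z → All (x ≤_) z → IsPartition (z ∷ʳ x)
IsPartition-∷ʳ⁺ [] [] = [-]
IsPartition-∷ʳ⁺ [-] (x≤p ∷ []) = x≤p ∷ [-]
IsPartition-∷ʳ⁺ (p≥q ∷ z) (_ ∷ x≤z) = p≥q ∷ IsPartition-∷ʳ⁺ z x≤z

IsPartition-∷ʳ⁻ : ∀ {x} z → IsPartition (z ∷ʳ x) → IsPartition z × All (x ≤_) z
IsPartition-∷ʳ⁻ [] _ = [] , []
IsPartition-∷ʳ⁻ (p ∷ []) (x≤p ∷ _) = [-] , x≤p ∷ []
IsPartition-∷ʳ⁻ (p ∷ q ∷ z) (q≤p ∷ rest) with IsPartition-∷ʳ⁻ (q ∷ z) rest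
... | part , x≤q ∷ x≤z = q≤p ∷ part , ≤-trans x≤q q≤p ∷ x≤q ∷ x≤z

sum-map-+ : ∀ c z → sumℕ (map (_+_ c) z) ≡ length z * c + sumℕ z
sum-map-+ c [] = refl
sum-map-+ c (p ∷ z) = trans (cong (_+_ (c + p)) (sum-map-+ c z)) (regroup c p (length z * c) (sumℕ z))
  where
  regroup : ∀ c p lc s → c + p + (lc + s) ≡ c + lc + (p + s)
  regroup = solve-∀

map-+-∸ : ∀ c z → All (c ≤_) z → map (_+_ c) (map (_∸ c) z) ≡ z
map-+-∸ c [] [] = refl
map-+-∸ c (p ∷ z) (c≤p ∷ c≤z) = cong₂ _∷_ (m+[n∸m]≡n c≤p) (map-+-∸ c z c≤z)

-- Parts may be 0.
EvenPartition : ℕ → List ℕ → Set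
EvenPartition ℓ z = length z ≡ ℓ × IsPartition z × All Even z

-- Adding a smallest part 2r and raising the other parts by 2r builds every even
-- partition with ℓ + 1 parts exactly once: 1/(q²;q²)_{ℓ+1} = 1/(q²;q²)_ℓ · 1/(1 - q^{2(ℓ+1)}).
bump : List ℕ → ℕ → List ℕ
bump w r = map (_+_ (2 * r)) w ∷ʳ 2 * r

bump-injective : ∀ {w w′ r r′} → bump w r ≡ bump w′ r′ → w ≡ w′ × r ≡ r′
bump-injective {w} {w′} {r} {r′} eq with init≡ , 2r≡2r′ ← ∷ʳ-injective _ _ eq
  with refl ← *-cancelˡ-≡ r r′ 2 2r≡2r′
  = map-injective (+-cancelˡ-≡ _ _ _) init≡ , refl

sum-bump : ∀ w r → sumℕ (bump w r) ≡ sumℕ w + r * (2 * suc (length w))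
sum-bump w r = begin
  sumℕ (map (_+_ (2 * r)) w ++ [ 2 * r ])      ≡⟨ sum-++ (map (_+_ (2 * r)) w) [ 2 * r ] ⟩
  sumℕ (map (_+_ (2 * r)) w) + (2 * r + 0)    ≡⟨ cong (_+ (2 * r + 0)) (sum-map-+ (2 * r) w) ⟩
  length w * (2 * r) + sumℕ w + (2 * r + 0)   ≡⟨ regroup (length w) r (sumℕ w) ⟩
  sumℕ w + r * (2 * suc (length w)) ∎
  where
  open ≡-Reasoning
  regroup : ∀ l r s → l * (2 * r) + s + (2 * r + 0) ≡ s + r * (2 * suc l)
  regroup = solve-∀

bump-EvenPartition : ∀ {ℓ w} r → EvenPartition ℓ w → EvenPartition (suc ℓ) (bump w r)
bump-EvenPartition {ℓ} {w} r (len , part , evens) =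
  trans (length-++ (map _ w)) (trans (cong (_+ 1) (trans (length-map _ w) len)) (+-comm ℓ 1)) ,
  IsPartition-∷ʳ⁺ (IsPartition-map (+-monoʳ-≤ (2 * r)) part)
    (All.map⁺ (All.tabulate (λ {p} _ → m≤m+n (2 * r) p))) ,
  All.∷ʳ⁺ (All.map⁺ (All.map (∣m∣n⇒∣m+n (Even-2* r)) evens)) (Even-2* r)

unbump : ∀ {ℓ z} → EvenPartition (suc ℓ) z → ∃[ w ] ∃[ r ] (EvenPartition ℓ w × z ≡ bump w r)
unbump {ℓ} {z} (len , part , evens) with initLast z
... | ini ∷ʳ′ x
  with part-ini , x≤ini ← IsPartition-∷ʳ⁻ ini part
     | evens-ini , divides r refl ← All.∷ʳ⁻ evens
  = w , r ,
    (trans (length-map _ ini) len-ini ,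
     IsPartition-map (∸-monoˡ-≤ x) part-ini ,
     All.map⁺ (All.map (λ e → Even-∸ e (divides r refl)) evens-ini)) ,
    cong₂ _∷ʳ_ (sym raise-w) (*-comm r 2)
  where
  w = map (_∸ x) ini
  len-ini : length ini ≡ ℓ
  len-ini = suc-injective (trans (+-comm 1 (length ini)) (trans (sym (length-++ ini)) len))
  raise-w : map (_+_ (2 * r)) w ≡ ini
  raise-w = trans (cong (λ c → map (_+_ c) w) (*-comm 2 r)) (map-+-∸ x ini x≤ini)

exactQuotient : (d : ℕ) .{{_ : NonZero d}} → ℕ → List ℕ
exactQuotient d m = if (m % d) ℕ.≡ᵇ 0 then [ m / d ] else []

length-exactQuotient : ∀ ℓ m → geom ℓ m ≡ + length (exactQuotient (2 * suc ℓ) m)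
length-exactQuotient ℓ m with (m % (2 * suc ℓ)) ℕ.≡ᵇ 0
... | true = refl
... | false = refl

module _ (d : ℕ) .{{d≢0 : NonZero d}} where

  ∈-exactQuotient⁺ : ∀ r → r ∈ exactQuotient d (r * d)
  ∈-exactQuotient⁺ r rewrite m*n%n≡0 r d {{d≢0}} | m*n/n≡m r d {{d≢0}} = here refl

  ∈-exactQuotient⁻ : ∀ {r m} → r ∈ exactQuotient d m → m ≡ r * d
  ∈-exactQuotient⁻ {r} {m} r∈ with (m % d) ℕ.≡ᵇ 0 in divisible | r∈
  ... | true | here refl =
    trans (m≡m%n+[m/n]*n m d) (cong (_+ m / d * d) (≡ᵇ⇒≡ (m % d) 0 (subst T (sym divisible) tt)))

  Unique-exactQuotient : ∀ m → Unique (exactQuotient d m)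
  Unique-exactQuotient m with (m % d) ℕ.≡ᵇ 0
  ... | true = [] ∷ []
  ... | false = []

evenPartitions : ℕ → ℕ → List (List ℕ)
evenPartitions zero = onlyAtZero []
evenPartitions (suc ℓ) = convolve bump (evenPartitions ℓ) (exactQuotient (2 * suc ℓ))

length-evenPartitions : ∀ ℓ n → invPoch2 ℓ n ≡ + length (evenPartitions ℓ n)
length-evenPartitions zero = length-onlyAtZero []
length-evenPartitions (suc ℓ) =
  length-convolve bump (evenPartitions ℓ) (exactQuotient (2 * suc ℓ)) (invPoch2 ℓ) (geom ℓ)
    (length-evenPartitions ℓ) (length-exactQuotient ℓ)

∈-evenPartitions⁻ : ∀ ℓ {n z} → z ∈ evenPartitions ℓ n → EvenPartition ℓ z × sumℕ z ≡ n
∈-evenPartitions⁻ zero z∈ with refl , refl ← ∈-onlyAtZero⁻ z∈ = (refl , [] , []) , refl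
∈-evenPartitions⁻ (suc ℓ) {n} z∈
  with i , w , r , i≤n , w∈ , r∈ , refl
         ← ∈-convolve⁻ bump (evenPartitions ℓ) (exactQuotient (2 * suc ℓ)) z∈
  with (len , part , evens) , refl ← ∈-evenPartitions⁻ ℓ {i} w∈
  = bump-EvenPartition r (len , part , evens) , (begin
    sumℕ (bump w r)                    ≡⟨ sum-bump w r ⟩
    sumℕ w + r * (2 * suc (length w))  ≡⟨ cong (λ l → sumℕ w + r * (2 * suc l)) len ⟩
    sumℕ w + r * (2 * suc ℓ)           ≡⟨ cong (_+_ (sumℕ w)) (∈-exactQuotient⁻ (2 * suc ℓ) r∈) ⟨
    sumℕ w + (n ∸ sumℕ w)              ≡⟨ m+[n∸m]≡n i≤n ⟩
    n ∎)
  where open ≡-Reasoning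

∈-evenPartitions⁺ : ∀ ℓ {z} → EvenPartition ℓ z → z ∈ evenPartitions ℓ (sumℕ z)
∈-evenPartitions⁺ zero {[]} _ = here refl
∈-evenPartitions⁺ (suc ℓ) ep with w , r , ep-w@(len , _) , refl ← unbump ep =
  ∈-convolve⁺ bump (evenPartitions ℓ) (exactQuotient (2 * suc ℓ))
    (subst (sumℕ w ≤_) (sym sum≡) (m≤m+n _ _)) (∈-evenPartitions⁺ ℓ ep-w)
    (subst (λ m → r ∈ exactQuotient (2 * suc ℓ) m) (sym rest≡) (∈-exactQuotient⁺ (2 * suc ℓ) r))
  where
  sum≡ : sumℕ (bump w r) ≡ sumℕ w + r * (2 * suc ℓ)
  sum≡ = trans (sum-bump w r) (cong (λ l → sumℕ w + r * (2 * suc l)) len)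
  rest≡ : sumℕ (bump w r) ∸ sumℕ w ≡ r * (2 * suc ℓ)
  rest≡ = trans (cong (_∸ sumℕ w) sum≡) (m+n∸m≡n (sumℕ w) (r * (2 * suc ℓ)))

Unique-evenPartitions : ∀ ℓ n → Unique (evenPartitions ℓ n)
Unique-evenPartitions zero = Unique-onlyAtZero []
Unique-evenPartitions (suc ℓ) =
  Unique-convolve bump (evenPartitions ℓ) (exactQuotient (2 * suc ℓ))
    (Unique-evenPartitions ℓ) (Unique-exactQuotient (2 * suc ℓ)) bump-injective
    (λ p q → trans (sym (proj₂ (∈-evenPartitions⁻ ℓ p))) (proj₂ (∈-evenPartitions⁻ ℓ q)))

-- Tuples of partitions with a given shape

totalSum : ∀ {k} → Vec (List ℕ) k → ℕ
totalSum y = sumℕ (map sumℕ (Vec.toList y))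

NonIncreasing : ∀ {k} → Vec ℕ k → Set
NonIncreasing [] = ⊤
NonIncreasing (x ∷ s) = at s 1 ≤ x × NonIncreasing s

Reduced : ∀ {k} → Vec ℕ k → Vec (List ℕ) k → Set
Reduced [] [] = ⊤
Reduced (x ∷ s) (z ∷ y) = EvenPartition (x ∸ at s 1) z × Reduced s y

sVec-NonIncreasing : ∀ {k} (x : Vec (List ℕ) k) → NonIncreasing (sVec x)
sVec-NonIncreasing [] = tt
sVec-NonIncreasing (z ∷ y) = m≤n+m _ (length z) , sVec-NonIncreasing y

sVec-Reduced : ∀ {k} {s : Vec ℕ k} {y} → NonIncreasing s → Reduced s y → sVec y ≡ s
sVec-Reduced {s = []} {[]} _ _ = refl
sVec-Reduced {s = x ∷ s} {z ∷ y} (s≤x , dec) ((len , _) , red) with refl ← sVec-Reduced dec red =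
  cong (_∷ sVec y) (trans (cong (_+ at (sVec y) 1) len) (m∸n+n≡m s≤x))

reducedTuples : ∀ {k} → Vec ℕ k → ℕ → List (Vec (List ℕ) k)
reducedTuples [] = onlyAtZero []
reducedTuples (x ∷ s) = convolve _∷_ (evenPartitions (x ∸ at s 1)) (reducedTuples s)

denom-∷ : ∀ {k} x (s : Vec ℕ k) → denom (suc k) (x ∷ s) ≡ mul (invPoch2 (x ∸ at s 1)) (denom k s)
denom-∷ {k} x s = cong (λ Fs → foldr mul one (invPoch2 (x ∸ at s 1) ∷ Fs))
  (trans (map-applyUpTo suc (factor (x ∷ s)) k) (sym (map-upTo (factor s) k)))
  where
  factor : ∀ {k} → Vec ℕ k → ℕ → Series
  factor s j = invPoch2 (at s (suc j) ∸ at s (suc (suc j)))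

length-reducedTuples : ∀ {k} (s : Vec ℕ k) n → denom k s n ≡ + length (reducedTuples s n)
length-reducedTuples [] = length-onlyAtZero []
length-reducedTuples {suc k} (x ∷ s) n = trans (cong (λ F → F n) (denom-∷ x s))
  (length-convolve _∷_ (evenPartitions (x ∸ at s 1)) (reducedTuples s) _ (denom k s)
    (length-evenPartitions (x ∸ at s 1)) (length-reducedTuples s) n)

∈-reducedTuples⁻ : ∀ {k} (s : Vec ℕ k) {n y} → y ∈ reducedTuples s n → Reduced s y × totalSum y ≡ n
∈-reducedTuples⁻ [] y∈ with refl , refl ← ∈-onlyAtZero⁻ y∈ = tt , refl
∈-reducedTuples⁻ (x ∷ s) {n} y∈
  with i , z , y , i≤n , z∈ , y∈′ , refl
         ← ∈-convolve⁻ _∷_ (evenPartitions (x ∸ at s 1)) (reducedTuples s) y∈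
  with ep , refl ← ∈-evenPartitions⁻ (x ∸ at s 1) z∈
  with red , sum-y ← ∈-reducedTuples⁻ s y∈′
  = (ep , red) , trans (cong (_+_ (sumℕ z)) sum-y) (m+[n∸m]≡n i≤n)

∈-reducedTuples⁺ : ∀ {k} (s : Vec ℕ k) {y} → Reduced s y → y ∈ reducedTuples s (totalSum y)
∈-reducedTuples⁺ [] {[]} _ = here refl
∈-reducedTuples⁺ (x ∷ s) {z ∷ y} (ep , red) =
  ∈-convolve⁺ _∷_ (evenPartitions (x ∸ at s 1)) (reducedTuples s) (m≤m+n _ _) (∈-evenPartitions⁺ _ ep)
    (subst (λ m → y ∈ reducedTuples s m) (sym (m+n∸m≡n (sumℕ z) (totalSum y))) (∈-reducedTuples⁺ s red))

Unique-reducedTuples : ∀ {k} (s : Vec ℕ k) n → Unique (reducedTuples s n)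
Unique-reducedTuples [] = Unique-onlyAtZero []
Unique-reducedTuples (x ∷ s) =
  Unique-convolve _∷_ (evenPartitions (x ∸ at s 1)) (reducedTuples s)
    (Unique-evenPartitions ℓ) (Unique-reducedTuples s) Vec.∷-injective
    (λ p q → trans (sym (proj₂ (∈-evenPartitions⁻ ℓ p))) (proj₂ (∈-evenPartitions⁻ ℓ q)))
  where ℓ = x ∸ at s 1

EvenPartsFrom : ℕ → List ℕ → Set
EvenPartsFrom c z = IsPartition z × All (λ p → Even p × c ≤ p) z

-- Entries are indexed from m = 1, as in InX.
AllEvenPartsFrom : ∀ {k} → (ℕ → ℕ) → Vec (List ℕ) k → Set
AllEvenPartsFrom {k} c x = (i : Fin k) → EvenPartsFrom (c (suc (toℕ i))) (lookup x i)

module _ {c : ℕ} (c-even : Even c) where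

  shift-EvenPartition : ∀ {ℓ w} → EvenPartition ℓ w → EvenPartsFrom c (map (_+_ c) w)
  shift-EvenPartition (_ , part , evens) =
    IsPartition-map (+-monoʳ-≤ c) part ,
    All.map⁺ (All.map (λ {p} e → ∣m∣n⇒∣m+n c-even e , m≤m+n c p) evens)

  unshift-EvenPartsFrom : ∀ {z} → EvenPartsFrom c z → EvenPartition (length z) (map (_∸ c) z)
  unshift-EvenPartsFrom {z} (part , parts) =
    length-map _ z ,
    IsPartition-map (∸-monoˡ-≤ c) part ,
    All.map⁺ (All.map (λ (e , _) → Even-∸ e c-even) parts)

shift : ∀ {k} → (ℕ → ℕ) → Vec (List ℕ) k → Vec (List ℕ) k
shift c [] = []
shift c (z ∷ y) = map (_+_ (c 1)) z ∷ shift (c ∘ suc) y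

unshift : ∀ {k} → (ℕ → ℕ) → Vec (List ℕ) k → Vec (List ℕ) k
unshift c [] = []
unshift c (z ∷ y) = map (_∸ c 1) z ∷ unshift (c ∘ suc) y

sVec-shift : ∀ {k} c (y : Vec (List ℕ) k) → sVec (shift c y) ≡ sVec y
sVec-shift c [] = refl
sVec-shift c (z ∷ y) =
  cong₂ (λ l s → (l + at s 1) ∷ s) (length-map (_+_ (c 1)) z) (sVec-shift (c ∘ suc) y)

shift-injective : ∀ {k} c {y y′ : Vec (List ℕ) k} → shift c y ≡ shift c y′ → y ≡ y′
shift-injective c {[]} {[]} _ = refl
shift-injective c {z ∷ y} {z′ ∷ y′} eq with head≡ , tail≡ ← Vec.∷-injective eq =
  cong₂ _∷_ (map-injective (+-cancelˡ-≡ (c 1) _ _) head≡) (shift-injective (c ∘ suc) tail≡)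

totalSum-shift : ∀ {k} c (y : Vec (List ℕ) k) →
  totalSum (shift c y) ≡ totalSum y + ∑[ j < k ] (length (lookup y j) * c (suc (toℕ j)))
totalSum-shift c [] = refl
totalSum-shift {suc k} c (z ∷ y) =
  trans (cong₂ _+_ (sum-map-+ (c 1) z) (totalSum-shift (c ∘ suc) y))
    (regroup (length z * c 1) (sumℕ z) (totalSum y) (∑[ j < k ] (length (lookup y j) * c (suc (suc (toℕ j))))))
  where
  regroup : ∀ l s t u → l + s + (t + u) ≡ s + t + (l + u)
  regroup = solve-∀

shift-Reduced : ∀ {k} {c : ℕ → ℕ} {s : Vec ℕ k} {y} → (∀ m → Even (c m)) →
  Reduced s y → AllEvenPartsFrom c (shift c y)
shift-Reduced {s = x ∷ s} {z ∷ y} c-even (ep , red) fzero = shift-EvenPartition (c-even 1) ep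
shift-Reduced {s = x ∷ s} {z ∷ y} c-even (ep , red) (fsuc i) = shift-Reduced (c-even ∘ suc) red i

unshift-Reduced : ∀ {k} {c : ℕ → ℕ} {x : Vec (List ℕ) k} → (∀ m → Even (c m)) →
  AllEvenPartsFrom c x → Reduced (sVec x) (unshift c x)
unshift-Reduced {x = []} _ _ = tt
unshift-Reduced {c = c} {z ∷ y} c-even parts =
  subst (λ ℓ → EvenPartition ℓ (map (_∸ c 1) z)) (sym (m+n∸n≡m (length z) (at (sVec y) 1)))
    (unshift-EvenPartsFrom (c-even 1) (parts fzero)) ,
  unshift-Reduced (c-even ∘ suc) (parts ∘ fsuc)

shift-unshift : ∀ {k} c {x : Vec (List ℕ) k} → AllEvenPartsFrom c x → shift c (unshift c x) ≡ x
shift-unshift c {[]} _ = refl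
shift-unshift c {z ∷ y} parts =
  cong₂ _∷_ (map-+-∸ (c 1) z (All.map proj₂ (proj₂ (parts fzero)))) (shift-unshift (c ∘ suc) (parts ∘ fsuc))

-- Rounding the part bounds up to even numbers

apCount : ℕ → ℕ → ℕ → ℕ
apCount n q m = ∑[ i < n ] 𝟙[ q + 2 * toℕ i ≤ m ]

apCount-suc : ∀ n q m → apCount (suc n) q m ≡ 𝟙[ q ≤ m ] + apCount n (q + 2) m
apCount-suc n q m = cong₂ _+_ (cong 𝟙[_≤ m ] (+-identityʳ q))
  (sum-cong-≗ {n} (λ i → cong 𝟙[_≤ m ] (step q (toℕ i))))
  where
  step : ∀ q i → q + 2 * suc i ≡ q + 2 + 2 * i
  step = solve-∀

apCount-zero : ∀ n {q m} → m < q → apCount n q m ≡ 0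
apCount-zero zero _ = refl
apCount-zero (suc n) {q} {m} m<q = trans (apCount-suc n q m)
  (cong₂ _+_ (𝟙-> m<q) (apCount-zero n (≤-trans m<q (m≤m+n q 2))))

apCount-≤ : ∀ n q m → apCount n q m ≤ n
apCount-≤ zero q m = z≤n
apCount-≤ (suc n) q m with q ≤? m
... | yes q≤m = subst (_≤ suc n) (sym (trans (apCount-suc n q m) (cong (_+ apCount n (q + 2) m) (𝟙-≤ q≤m))))
                  (s≤s (apCount-≤ n (q + 2) m))
... | no q≰m = subst (_≤ suc n) (sym (apCount-zero (suc n) (≰⇒> q≰m))) z≤n

apCount-upper : ∀ n q m → 2 * apCount n q m ≤ suc (suc m) ∸ q
apCount-upper zero q m = z≤n
apCount-upper (suc n) q m with q ≤? m
... | no q≰m rewrite apCount-zero (suc n) (≰⇒> q≰m) = z≤n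
... | yes q≤m rewrite apCount-suc n q m | 𝟙-≤ q≤m = begin
  2 * suc C                       ≡⟨ *-suc 2 C ⟩
  2 + 2 * C                       ≤⟨ +-monoʳ-≤ 2 (apCount-upper n (q + 2) m) ⟩
  2 + (suc (suc m) ∸ (q + 2))     ≡⟨ cong (_+_ 2) (sym (∸-+-assoc (2 + m) q 2)) ⟩
  2 + ((2 + m) ∸ q ∸ 2)           ≡⟨ cong (λ d → 2 + (d ∸ 2)) (+-∸-assoc 2 q≤m) ⟩
  2 + (m ∸ q)                     ≡⟨ +-∸-assoc 2 q≤m ⟨
  suc (suc m) ∸ q ∎
  where
  open ≤-Reasoning
  C = apCount n (q + 2) m

apCount-lower : ∀ n q m → apCount n q m < n → m < q + 2 * apCount n q m
apCount-lower (suc n) q m C<n with q ≤? m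
... | no q≰m rewrite apCount-zero (suc n) (≰⇒> q≰m) = ≤-trans (≰⇒> q≰m) (m≤m+n q 0)
... | yes q≤m rewrite apCount-suc n q m | 𝟙-≤ q≤m = begin-strict
  m                    <⟨ apCount-lower n (q + 2) m (ℕ.s≤s⁻¹ C<n) ⟩
  q + 2 + 2 * C        ≡⟨ regroup q C ⟩
  q + 2 * suc C ∎
  where
  open ≤-Reasoning
  C = apCount n (q + 2) m
  regroup : ∀ q C → q + 2 + 2 * C ≡ q + 2 * suc C
  regroup = solve-∀

Even-≤-suc : ∀ {c c′ p} → Even c → Even p → c ≤ suc c′ → c′ ≤ p → c ≤ p
Even-≤-suc {c} {c′} {p} c-even p-even c≤1+c′ c′≤p with c ≤? p
... | yes c≤p = c≤p
... | no c≰p = contradiction (∣1⇒≡1 (∣m+n∣m⇒∣n (subst Even (+-comm 1 p) 1+p-even) p-even)) λ ()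
  where
  1+p-even : Even (suc p)
  1+p-even = subst Even (≤-antisym (≤-trans c≤1+c′ (s≤s c′≤p)) (≰⇒> c≰p)) c-even

EvenPartsFrom-roundUp : ∀ {c c′ z} → Even c → c′ ≤ c → c ≤ suc c′ →
  EvenPartsFrom c′ z ⇔ EvenPartsFrom c z
EvenPartsFrom-roundUp c-even c′≤c c≤1+c′ = mk⇔
  (λ (part , parts) → part , All.map (λ (e , c′≤p) → e , Even-≤-suc c-even e c≤1+c′ c′≤p) parts)
  (λ (part , parts) → part , All.map (λ (e , c≤p) → e , ≤-trans c′≤c c≤p) parts)

2*m≡m+m : ∀ m → 2 * m ≡ m + m
2*m≡m+m m = cong (_+_ m) (+-identityʳ m)

module PartBounds (a b k : ℕ) (2a+2b≤1+k : 2 * a + 2 * b ≤ suc k) where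

  K : ℕ
  K = (k + 1) ∸ 2 * b

  partBound : ℕ → ℕ
  partBound m = m + (m ∸ 2 * a) + (m ∸ K)

  -- #{1 ≤ i ≤ a : 2i ≤ m} and #{1 ≤ i ≤ b : k - 2b + 2i ≤ m}
  aCount bCount : ℕ → ℕ
  aCount m = apCount a 2 m
  bCount m = apCount b (suc K) m

  -- partBound m rounded up to an even number, in the form that makes the weight
  -- of a shifted tuple produce the exponent of the sum side.
  evenBound : ℕ → ℕ
  evenBound m = m + (m ∸ 2 * aCount m) + 2 * bCount m

  2b≤1+k : 2 * b ≤ k + 1
  2b≤1+k = subst (2 * b ≤_) (+-comm 1 k) (m+n≤o⇒n≤o (2 * a) 2a+2b≤1+k)

  2a≤K : 2 * a ≤ K
  2a≤K = m+n≤o⇒m≤o∸n (2 * a) (subst (2 * a + 2 * b ≤_) (+-comm 1 k) 2a+2b≤1+k)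

  m≤partBound : ∀ m → m ≤ partBound m
  m≤partBound m = ≤-trans (m≤m+n m (m ∸ 2 * a)) (m≤m+n _ (m ∸ K))

  2aCount≤m : ∀ m → 2 * aCount m ≤ m
  2aCount≤m m = apCount-upper a 2 m

  evenBound-+ : ∀ m → evenBound m + 2 * aCount m ≡ 2 * m + 2 * bCount m
  evenBound-+ m = begin
    m + (m ∸ 2 * A) + 2 * B + 2 * A     ≡⟨ regroup m (m ∸ 2 * A) (2 * B) (2 * A) ⟩
    m + (m ∸ 2 * A + 2 * A) + 2 * B     ≡⟨ cong (λ d → m + d + 2 * B) (m∸n+n≡m (2aCount≤m m)) ⟩
    m + m + 2 * B                       ≡⟨ cong (_+ 2 * B) (2*m≡m+m m) ⟨
    2 * m + 2 * B ∎
    where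
    open ≡-Reasoning
    A = aCount m
    B = bCount m
    regroup : ∀ m d b a → m + d + b + a ≡ m + (d + a) + b
    regroup = solve-∀

  evenBound-even : ∀ m → Even (evenBound m)
  evenBound-even m = ∣m∣n⇒∣m+n (divides (m ∸ aCount m) (begin
    m + (m ∸ 2 * aCount m)     ≡⟨ +-∸-assoc m (2aCount≤m m) ⟨
    m + m ∸ 2 * aCount m       ≡⟨ cong (_∸ 2 * aCount m) (2*m≡m+m m) ⟨
    2 * m ∸ 2 * aCount m       ≡⟨ *-distribˡ-∸ 2 m (aCount m) ⟨
    2 * (m ∸ aCount m)         ≡⟨ *-comm 2 (m ∸ aCount m) ⟩
    (m ∸ aCount m) * 2 ∎)) (Even-2* (bCount m))
    where open ≡-Reasoning

  partBound≤evenBound : ∀ {m} → m ≤ k → partBound m ≤ evenBound m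
  partBound≤evenBound {m} m≤k =
    +-mono-≤ (+-monoʳ-≤ m (∸-monoʳ-≤ m (*-monoʳ-≤ 2 (apCount-≤ a 2 m)))) m∸K≤2bCount
    where
    m∸K≤2bCount : m ∸ K ≤ 2 * bCount m
    m∸K≤2bCount with m≤n⇒m<n∨m≡n (apCount-≤ b (suc K) m)
    ... | inj₁ bCount<b = m≤n+o⇒m∸n≤o m K (ℕ.s≤s⁻¹ (apCount-lower b (suc K) m bCount<b))
    ... | inj₂ bCount≡b = begin
      m ∸ K            ≤⟨ ∸-monoˡ-≤ K (≤-trans m≤k (m≤m+n k 1)) ⟩
      (k + 1) ∸ K      ≡⟨ m∸[m∸n]≡n 2b≤1+k ⟩
      2 * b            ≡⟨ cong (2 *_) bCount≡b ⟨
      2 * bCount m ∎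
      where open ≤-Reasoning

  evenBound≤1+partBound : ∀ {m} → m ≤ k → evenBound m ≤ suc (partBound m)
  evenBound≤1+partBound {m} m≤k with m≤n⇒m<n∨m≡n (apCount-≤ a 2 m)
  ... | inj₂ aCount≡a rewrite aCount≡a = begin
    m + (m ∸ 2 * a) + 2 * bCount m        ≤⟨ +-monoʳ-≤ (m + (m ∸ 2 * a)) 2bCount≤1+[m∸K] ⟩
    m + (m ∸ 2 * a) + suc (m ∸ K)         ≡⟨ +-suc (m + (m ∸ 2 * a)) (m ∸ K) ⟩
    suc (partBound m) ∎
    where
    open ≤-Reasoning
    2bCount≤1+[m∸K] : 2 * bCount m ≤ suc (m ∸ K)
    2bCount≤1+[m∸K] = ≤-trans (apCount-upper b (suc K) m)
      (m≤n+o⇒m∸n≤o (suc m) K (≤-trans (s≤s (m≤n+m∸n m K)) (≤-reflexive (sym (+-suc K (m ∸ K))))))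
  ... | inj₁ aCount<a = begin
    m + (m ∸ 2 * aCount m) + 2 * bCount m ≡⟨ cong (_+_ (m + (m ∸ 2 * aCount m))) 2bCount≡0 ⟩
    m + (m ∸ 2 * aCount m) + 0            ≡⟨ +-identityʳ _ ⟩
    m + (m ∸ 2 * aCount m)                ≤⟨ +-monoʳ-≤ m m∸2aCount≤1 ⟩
    m + 1                                 ≡⟨ +-comm m 1 ⟩
    suc m                                 ≤⟨ s≤s (m≤partBound m) ⟩
    suc (partBound m) ∎
    where
    open ≤-Reasoning
    m≤1+2aCount : m ≤ suc (2 * aCount m)
    m≤1+2aCount = ℕ.s≤s⁻¹ (apCount-lower a 2 m aCount<a)
    m<K : m < K
    m<K = begin-strict
      m                   <⟨ s≤s m≤1+2aCount ⟩
      2 + 2 * aCount m    ≡⟨ *-suc 2 (aCount m) ⟨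
      2 * suc (aCount m)  ≤⟨ *-monoʳ-≤ 2 aCount<a ⟩
      2 * a               ≤⟨ 2a≤K ⟩
      K ∎
    2bCount≡0 : 2 * bCount m ≡ 0
    2bCount≡0 = n≤0⇒n≡0 (≤-trans (apCount-upper b (suc K) m) (≤-reflexive (m≤n⇒m∸n≡0 m<K)))
    m∸2aCount≤1 : m ∸ 2 * aCount m ≤ 1
    m∸2aCount≤1 = m≤n+o⇒m∸n≤o m (2 * aCount m) (subst (m ≤_) (+-comm 1 (2 * aCount m)) m≤1+2aCount)

  InX⇔evenBound : ∀ {x : Vec (List ℕ) k} → InX a b k x ⇔ AllEvenPartsFrom evenBound x
  InX⇔evenBound = mk⇔ (λ inX i → Equivalence.to (roundUp i) (inX i))
                      (λ parts i → Equivalence.from (roundUp i) (parts i))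
    where
    roundUp : ∀ {z} (i : Fin k) →
      EvenPartsFrom (partBound (suc (toℕ i))) z ⇔ EvenPartsFrom (evenBound (suc (toℕ i))) z
    roundUp i = EvenPartsFrom-roundUp (evenBound-even (suc (toℕ i)))
      (partBound≤evenBound (toℕ<n i)) (evenBound≤1+partBound (toℕ<n i))

-- The weight of a tuple and its frame sequence

at-sVec : ∀ {k} (x : Vec (List ℕ) k) p →
  at (sVec x) (suc p) ≡ ∑[ j < k ] (length (lookup x j) * 𝟙[ p ≤ toℕ j ])
at-sVec [] p = refl
at-sVec (z ∷ y) zero = cong₂ _+_ (sym (*-identityʳ (length z))) (at-sVec y 0)
at-sVec {suc k} (z ∷ y) (suc p) =
  trans (at-sVec y p) (cong (_+ ∑[ j < k ] (length (lookup y j) * 𝟙[ p ≤ toℕ j ])) (sym (*-zeroʳ (length z))))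

sVec-≤-head : ∀ {k} (x : Vec (List ℕ) k) (i : Fin k) → at (sVec x) (suc (toℕ i)) ≤ at (sVec x) 1
sVec-≤-head (z ∷ y) fzero = ≤-refl
sVec-≤-head (z ∷ y) (fsuc i) = ≤-trans (sVec-≤-head y i) (m≤n+m _ (length z))

-- Abel summation: s_m = ℓ_m + ⋯ + ℓ_k, so a sum of entries of s is a weighted sum of the ℓ_j.
∑-at-sVec : ∀ {k n} (x : Vec (List ℕ) k) (f : Fin n → ℕ) →
  ∑[ i < n ] at (sVec x) (suc (f i)) ≡ ∑[ j < k ] (length (lookup x j) * ∑[ i < n ] 𝟙[ f i ≤ toℕ j ])
∑-at-sVec {k} {n} x f = begin
  ∑[ i < n ] at (sVec x) (suc (f i))
    ≡⟨ sum-cong-≗ {n} (λ i → at-sVec x (f i)) ⟩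
  ∑[ i < n ] ∑[ j < k ] (length (lookup x j) * 𝟙[ f i ≤ toℕ j ])
    ≡⟨ ∑-comm {n} {k} _ ⟩
  ∑[ j < k ] ∑[ i < n ] (length (lookup x j) * 𝟙[ f i ≤ toℕ j ])
    ≡⟨ sum-cong-≗ {k} (λ j → *-distribˡ-sum {n} (length (lookup x j)) _) ⟨
  ∑[ j < k ] (length (lookup x j) * ∑[ i < n ] 𝟙[ f i ≤ toℕ j ]) ∎
  where open ≡-Reasoning

∑-sVec : ∀ {k} (x : Vec (List ℕ) k) →
  ∑[ i < k ] at (sVec x) (suc (toℕ i)) ≡ ∑[ j < k ] (length (lookup x j) * suc (toℕ j))
∑-sVec {k} x = trans (∑-at-sVec {k} {k} x toℕ)
  (sum-cong-≗ {k} (λ j → cong (length (lookup x j) *_) (∑-𝟙≤ (toℕ j) (toℕ<n j))))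

length-filter-< : ∀ t (L : List ℕ) → length (filter (t <?_) L) ≡ sumℕ (map (λ v → 𝟙[ suc t ≤ v ]) L)
length-filter-< t [] = refl
length-filter-< t (v ∷ L) with t <? v
... | yes t<v = trans (cong length (filter-accept (t <?_) t<v))
                      (cong₂ _+_ (sym (𝟙-≤ t<v)) (length-filter-< t L))
... | no t≮v = trans (cong length (filter-reject (t <?_) t≮v))
                     (cong₂ _+_ (sym (𝟙-> (s≤s (≮⇒≥ t≮v)))) (length-filter-< t L))

module _ {k} (x : Vec (List ℕ) k) where

  private
    s : Fin k → ℕ
    s i = at (sVec x) (suc (toℕ i))
    M = at (sVec x) 1
    count : ℕ → ℕ
    count t = length (filter (t <?_) (Vec.toList (sVec x)))

  sum-weighted-count : ∀ (g : ℕ → ℕ) →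
    sumℕ (map (λ t → g t * count t) (upTo M)) ≡ ∑[ i < k ] ∑[ t < s i ] g (toℕ t)
  sum-weighted-count g = begin
    sumℕ (map (λ t → g t * count t) (upTo M))
      ≡⟨ sum-map-upTo _ M ⟩
    ∑[ t < M ] (g (toℕ t) * count (toℕ t))
      ≡⟨ sum-cong-≗ {M} (λ t → cong (g (toℕ t) *_)
           (trans (length-filter-< (toℕ t) (Vec.toList (sVec x))) (sum-map-toList 𝟙[ suc (toℕ t) ≤_] (sVec x)))) ⟩
    ∑[ t < M ] (g (toℕ t) * ∑[ i < k ] 𝟙[ suc (toℕ t) ≤ s i ])
      ≡⟨ ∑-columns M g s (sVec-≤-head x) ⟩
    ∑[ i < k ] ∑[ t < s i ] g (toℕ t) ∎
    where open ≡-Reasoning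

  gfsWeight-fs : gfsWeight (fs -[1+ 0 ] x) ≡ + ∑[ i < k ] (s i * s i) ℤ.- + (2 * ∑[ i < k ] s i)
  gfsWeight-fs = begin
    gfsWeight (fs -[1+ 0 ] x)
      ≡⟨ cong sumℤ (map-∘ (upTo M)) ⟨
    sumℤ (map (λ t → (-[1+ 0 ] ℤ.+ + (2 * t)) ℤ.* + count t) (upTo M))
      ≡⟨ cong sumℤ (map-cong (λ t → term (2 * t) (count t)) (upTo M)) ⟩
    sumℤ (map (λ t → + ((2 * t + 1) * count t) ℤ.- + (2 * count t)) (upTo M))
      ≡⟨ sumℤ-map-- _ _ (upTo M) ⟩
    + sumℕ (map (λ t → (2 * t + 1) * count t) (upTo M)) ℤ.- + sumℕ (map (λ t → 2 * count t) (upTo M))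
      ≡⟨ cong₂ (λ p q → + p ℤ.- + q)
               (sum-weighted-count (λ t → 2 * t + 1)) (sum-weighted-count (λ _ → 2)) ⟩
    + ∑[ i < k ] ∑[ t < s i ] (2 * toℕ t + 1) ℤ.- + ∑[ i < k ] ∑[ t < s i ] 2
      ≡⟨ cong₂ (λ p q → + p ℤ.- + q)
               (sum-cong-≗ {k} (∑-odd ∘ s)) (sum-cong-≗ {k} (λ i → trans (∑-const (s i) 2) (*-comm (s i) 2))) ⟩
    + ∑[ i < k ] (s i * s i) ℤ.- + ∑[ i < k ] (2 * s i)
      ≡⟨ cong (λ q → + ∑[ i < k ] (s i * s i) ℤ.- + q) (*-distribˡ-sum {k} 2 s) ⟨
    + ∑[ i < k ] (s i * s i) ℤ.- + (2 * ∑[ i < k ] s i) ∎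
    where
    open ≡-Reasoning
    term : ∀ m c → (-[1+ 0 ] ℤ.+ + m) ℤ.* + c ≡ + ((m + 1) * c) ℤ.- + (2 * c)
    term m c = begin
      (-[1+ 0 ] ℤ.+ + m) ℤ.* + c                   ≡⟨ ring (+ m) (+ c) ⟩
      (+ m ℤ.+ + 1) ℤ.* + c ℤ.- + 2 ℤ.* + c        ≡⟨ cong₂ ℤ._-_ (ℤ.pos-* (m + 1) c) (ℤ.pos-* 2 c) ⟨
      + ((m + 1) * c) ℤ.- + (2 * c) ∎
      where
      ring : ∀ M C → (ℤ.- + 1 ℤ.+ M) ℤ.* C ≡ (M ℤ.+ + 1) ℤ.* C ℤ.- + 2 ℤ.* C
      ring = ℤ-Solver.solve-∀

n≤n*n : ∀ n → n ≤ n * n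
n≤n*n zero = z≤n
n≤n*n (suc n) = m≤m*n (suc n) (suc n)

2n≤n*n+1 : ∀ n → n + n ≤ n * n + 1
2n≤n*n+1 zero = z≤n
2n≤n*n+1 (suc n) = subst₂ _≤_ (sym (lhs n)) (sym (rhs n)) (m≤n+m (2 + 2 * n) (n * n))
  where
  lhs : ∀ n → suc n + suc n ≡ 2 + 2 * n
  lhs = solve-∀
  rhs : ∀ n → suc n * suc n + 1 ≡ n * n + (2 + 2 * n)
  rhs = solve-∀

length*-≤-sum : ∀ {c} z → All (c ≤_) z → length z * c ≤ sumℕ z
length*-≤-sum [] [] = z≤n
length*-≤-sum (p ∷ z) (c≤p ∷ c≤z) = +-mono-≤ c≤p (length*-≤-sum z c≤z)

∑-length*-≤-totalSum : ∀ {k} (c : ℕ → ℕ) (x : Vec (List ℕ) k) →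
  ((i : Fin k) → All (c (suc (toℕ i)) ≤_) (lookup x i)) →
  ∑[ j < k ] (length (lookup x j) * c (suc (toℕ j))) ≤ totalSum x
∑-length*-≤-totalSum c [] _ = z≤n
∑-length*-≤-totalSum c (z ∷ y) parts≥ =
  +-mono-≤ (length*-≤-sum z (parts≥ fzero)) (∑-length*-≤-totalSum (c ∘ suc) y (parts≥ ∘ fsuc))

≤∣∣+1 : ∀ N {W Q s} → N ℤ.+ + Q ≡ + W → s + Q ≤ W + 1 → s ≤ ℤ.∣ N ∣ + 1
≤∣∣+1 (+ n) {W} {Q} {s} n+Q≡W s+Q≤W+1 = +-cancelʳ-≤ Q s (n + 1) (begin
  s + Q        ≤⟨ s+Q≤W+1 ⟩
  W + 1        ≡⟨ cong (_+ 1) (ℤ.+-injective n+Q≡W) ⟨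
  n + Q + 1    ≡⟨ regroup n Q ⟩
  n + 1 + Q ∎)
  where
  open ≤-Reasoning
  regroup : ∀ n Q → n + Q + 1 ≡ n + 1 + Q
  regroup = solve-∀
≤∣∣+1 -[1+ n ] {s = zero} _ _ = z≤n
≤∣∣+1 -[1+ n ] {W} {Q} {suc s} N+Q≡W s+Q≤W+1 = contradiction (begin-strict
  W + 1                <⟨ s≤s (≤-trans (m≤m+n (W + 1) (s + n)) (≤-reflexive (regroup W s n))) ⟩
  suc s + (W + suc n)  ≡⟨ cong (_+_ (suc s)) Q≡W+1+n ⟨
  suc s + Q            ≤⟨ s+Q≤W+1 ⟩
  W + 1 ∎) (<-irrefl refl)
  where
  open ≤-Reasoning
  regroup : ∀ W s n → W + 1 + (s + n) ≡ s + (W + suc n)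
  regroup = solve-∀
  cancel : ∀ N Q → Q ≡ (N ℤ.+ Q) ℤ.- N
  cancel = ℤ-Solver.solve-∀
  Q≡W+1+n : Q ≡ W + suc n
  Q≡W+1+n = ℤ.+-injective (trans (cancel -[1+ n ] (+ Q)) (cong (ℤ._- -[1+ n ]) N+Q≡W))

head+∑≤∑-squares+1 : ∀ {n} (v : Fin (suc n) → ℕ) → v fzero + sum v ≤ ∑[ i < suc n ] (v i * v i) + 1
head+∑≤∑-squares+1 {n} v = begin
  v₀ + (v₀ + sum (v ∘ fsuc))                            ≡⟨ +-assoc v₀ v₀ _ ⟨
  v₀ + v₀ + sum (v ∘ fsuc)                              ≤⟨ +-mono-≤ (2n≤n*n+1 v₀) (∑-mono-≤ (n≤n*n ∘ v ∘ fsuc)) ⟩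
  v₀ * v₀ + 1 + ∑[ i < n ] (v (fsuc i) * v (fsuc i))   ≡⟨ regroup (v₀ * v₀) _ ⟩
  v₀ * v₀ + ∑[ i < n ] (v (fsuc i) * v (fsuc i)) + 1 ∎
  where
  open ≤-Reasoning
  v₀ = v fzero
  regroup : ∀ a b → a + 1 + b ≡ a + b + 1
  regroup = solve-∀

-- If the m-th partition has parts ≥ m, then ∑ |λ^(m)| ≥ ∑ s_m, so the weight is at
-- least ∑ s_m (s_m - 1) ≥ s_1 - 1.
s₁-bound : ∀ {k} (x : Vec (List ℕ) k) → ((i : Fin k) → All (suc (toℕ i) ≤_) (lookup x i)) →
  at (sVec x) 1 ≤ ℤ.∣ pairWeight x ∣ + 1
s₁-bound [] _ = z≤n
s₁-bound {suc k} x parts≥ = ≤∣∣+1 (pairWeight x) {V + P} weight+2Q (begin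
  s fzero + 2 * Q          ≡⟨ cong (_+_ (s fzero)) (2*m≡m+m Q) ⟩
  s fzero + (Q + Q)        ≡⟨ +-assoc (s fzero) Q Q ⟨
  s fzero + Q + Q          ≤⟨ +-mono-≤ (head+∑≤∑-squares+1 s) Q≤V ⟩
  P + 1 + V                ≡⟨ regroup P V ⟩
  V + P + 1 ∎)
  where
  open ≤-Reasoning
  s : Fin (suc k) → ℕ
  s i = at (sVec x) (suc (toℕ i))
  V = totalSum x
  P = ∑[ i < suc k ] (s i * s i)
  Q = sum s
  Q≤V : Q ≤ V
  Q≤V = ≤-trans (≤-reflexive (∑-sVec x)) (∑-length*-≤-totalSum (λ m → m) x parts≥)
  weight+2Q : pairWeight x ℤ.+ + (2 * Q) ≡ + (V + P)
  weight+2Q = trans (cong (λ g → (+ V ℤ.+ g) ℤ.+ + (2 * Q)) (gfsWeight-fs x)) (cancel (+ V) (+ P) (+ (2 * Q)))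
    where
    cancel : ∀ V P Q → V ℤ.+ (P ℤ.- Q) ℤ.+ Q ≡ V ℤ.+ P
    cancel = ℤ-Solver.solve-∀
  regroup : ∀ P V → P + 1 + V ≡ V + P + 1
  regroup = solve-∀

trade-terms : ∀ T C P Q SA SB → C + SA ≡ Q + SB →
  + (T + C) ℤ.+ (+ P ℤ.- + Q) ≡ + T ℤ.+ ((+ P ℤ.- + SA) ℤ.+ + SB)
trade-terms T C P Q SA SB C+SA≡Q+SB = begin
  + (T + C) ℤ.+ (+ P ℤ.- + Q)
    ≡⟨ split (+ T) (+ C) (+ P) (+ Q) (+ SA) (+ SB) ⟩
  + T ℤ.+ ((+ P ℤ.- + SA) ℤ.+ + SB) ℤ.+ (+ (C + SA) ℤ.- + (Q + SB))
    ≡⟨ cong (λ e → + T ℤ.+ ((+ P ℤ.- + SA) ℤ.+ + SB) ℤ.+ (+ e ℤ.- + (Q + SB))) C+SA≡Q+SB ⟩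
  + T ℤ.+ ((+ P ℤ.- + SA) ℤ.+ + SB) ℤ.+ (+ (Q + SB) ℤ.- + (Q + SB))
    ≡⟨ drop (+ T ℤ.+ ((+ P ℤ.- + SA) ℤ.+ + SB)) (+ (Q + SB)) ⟩
  + T ℤ.+ ((+ P ℤ.- + SA) ℤ.+ + SB) ∎
  where
  open ≡-Reasoning
  split : ∀ T C P Q SA SB →
    T ℤ.+ C ℤ.+ (P ℤ.- Q) ≡ T ℤ.+ ((P ℤ.- SA) ℤ.+ SB) ℤ.+ ((C ℤ.+ SA) ℤ.- (Q ℤ.+ SB))
  split = ℤ-Solver.solve-∀
  drop : ∀ X Y → X ℤ.+ (Y ℤ.- Y) ≡ X
  drop = ℤ-Solver.solve-∀

module ShiftedWeight (a b k : ℕ) (2a+2b≤1+k : 2 * a + 2 * b ≤ suc k) where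
  open PartBounds a b k 2a+2b≤1+k

  top-index : ∀ i → (k + 2 * suc i) ∸ 2 * b ≡ suc (K + 2 * i)
  top-index i = begin
    (k + 2 * suc i) ∸ 2 * b        ≡⟨ cong (_∸ 2 * b) (regroup k i) ⟩
    (k + 1 + suc (2 * i)) ∸ 2 * b  ≡⟨ +-∸-comm (suc (2 * i)) 2b≤1+k ⟩
    K + suc (2 * i)                ≡⟨ +-suc K (2 * i) ⟩
    suc (K + 2 * i) ∎
    where
    open ≡-Reasoning
    regroup : ∀ k i → k + 2 * suc i ≡ k + 1 + suc (2 * i)
    regroup = solve-∀

  module _ (y : Vec (List ℕ) k) where

    private
      s = sVec y
      ℓ : Fin k → ℕ
      ℓ j = length (lookup y j)

    ∑-at-even : sumℕ (map (λ i → at s (2 * suc i)) (upTo a)) ≡ ∑[ j < k ] (ℓ j * aCount (suc (toℕ j)))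
    ∑-at-even = begin
      sumℕ (map (λ i → at s (2 * suc i)) (upTo a))  ≡⟨ sum-map-upTo _ a ⟩
      ∑[ i < a ] at s (2 * suc (toℕ i))             ≡⟨ sum-cong-≗ {a} (λ i → cong (at s) (*-suc 2 (toℕ i))) ⟩
      ∑[ i < a ] at s (suc (1 + 2 * toℕ i))         ≡⟨ ∑-at-sVec {k} {a} y (λ i → 1 + 2 * toℕ i) ⟩
      ∑[ j < k ] (ℓ j * aCount (suc (toℕ j))) ∎
      where open ≡-Reasoning

    ∑-at-top : sumℕ (map (λ i → at s ((k + 2 * suc i) ∸ 2 * b)) (upTo b))
             ≡ ∑[ j < k ] (ℓ j * bCount (suc (toℕ j)))
    ∑-at-top = begin
      sumℕ (map (λ i → at s ((k + 2 * suc i) ∸ 2 * b)) (upTo b))  ≡⟨ sum-map-upTo _ b ⟩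
      ∑[ i < b ] at s ((k + 2 * suc (toℕ i)) ∸ 2 * b)              ≡⟨ sum-cong-≗ {b} (λ i → cong (at s) (top-index (toℕ i))) ⟩
      ∑[ i < b ] at s (suc (K + 2 * toℕ i))                        ≡⟨ ∑-at-sVec {k} {b} y (λ i → K + 2 * toℕ i) ⟩
      ∑[ j < k ] (ℓ j * bCount (suc (toℕ j))) ∎
      where open ≡-Reasoning

    ∑-evenBound : ∑[ j < k ] (ℓ j * evenBound (suc (toℕ j))) + 2 * ∑[ j < k ] (ℓ j * aCount (suc (toℕ j)))
                ≡ 2 * ∑[ j < k ] (ℓ j * suc (toℕ j)) + 2 * ∑[ j < k ] (ℓ j * bCount (suc (toℕ j)))
    ∑-evenBound = begin
      ∑[ j < k ] (ℓ j * c j) + 2 * ∑[ j < k ] (ℓ j * A j)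
        ≡⟨ cong (_+_ (∑[ j < k ] (ℓ j * c j))) (*-distribˡ-sum {k} 2 _) ⟩
      ∑[ j < k ] (ℓ j * c j) + ∑[ j < k ] (2 * (ℓ j * A j))
        ≡⟨ ∑-distrib-+ {k} _ _ ⟨
      ∑[ j < k ] (ℓ j * c j + 2 * (ℓ j * A j))
        ≡⟨ sum-cong-≗ {k} pointwise ⟩
      ∑[ j < k ] (2 * (ℓ j * suc (toℕ j)) + 2 * (ℓ j * B j))
        ≡⟨ ∑-distrib-+ {k} _ _ ⟩
      ∑[ j < k ] (2 * (ℓ j * suc (toℕ j))) + ∑[ j < k ] (2 * (ℓ j * B j))
        ≡⟨ cong₂ _+_ (*-distribˡ-sum {k} 2 _) (*-distribˡ-sum {k} 2 _) ⟨
      2 * ∑[ j < k ] (ℓ j * suc (toℕ j)) + 2 * ∑[ j < k ] (ℓ j * B j) ∎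
      where
      open ≡-Reasoning
      c A B : Fin k → ℕ
      c j = evenBound (suc (toℕ j))
      A j = aCount (suc (toℕ j))
      B j = bCount (suc (toℕ j))
      scale : ∀ l c a m b → c + 2 * a ≡ 2 * m + 2 * b → l * c + 2 * (l * a) ≡ 2 * (l * m) + 2 * (l * b)
      scale l c a m b eq = trans (distrib₁ l c a) (trans (cong (l *_) eq) (distrib₂ l m b))
        where
        distrib₁ : ∀ l c a → l * c + 2 * (l * a) ≡ l * (c + 2 * a)
        distrib₁ = solve-∀
        distrib₂ : ∀ l m b → l * (2 * m + 2 * b) ≡ 2 * (l * m) + 2 * (l * b)
        distrib₂ = solve-∀
      pointwise : ∀ j → ℓ j * c j + 2 * (ℓ j * A j) ≡ 2 * (ℓ j * suc (toℕ j)) + 2 * (ℓ j * B j)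
      pointwise j = scale (ℓ j) (c j) (A j) (suc (toℕ j)) (B j) (evenBound-+ (suc (toℕ j)))

    pairWeight-shift : pairWeight (shift evenBound y) ≡ + totalSum y ℤ.+ expo a b k s
    pairWeight-shift = begin
      + totalSum (shift evenBound y) ℤ.+ gfsWeight (fs -[1+ 0 ] (shift evenBound y))
        ≡⟨ cong₂ ℤ._+_ (cong +_ (totalSum-shift evenBound y))
                        (trans (gfsWeight-fs (shift evenBound y)) (cong squares-2sum (sVec-shift evenBound y))) ⟩
      + (totalSum y + C) ℤ.+ (+ P ℤ.- + (2 * Q))
        ≡⟨ trade-terms (totalSum y) C P (2 * Q) (2 * SA) (2 * SB)
             (trans ∑-evenBound (cong₂ (λ q r → 2 * q + 2 * r) (sym (∑-sVec y)) (sym ∑-at-top))) ⟩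
      + totalSum y ℤ.+ ((+ P ℤ.- + (2 * SA)) ℤ.+ + (2 * SB))
        ≡⟨ cong₂ (λ p q → + totalSum y ℤ.+ ((+ p ℤ.- + (2 * q)) ℤ.+ + (2 * SB)))
                  (sym (sum-map-upTo (λ j → at s (suc j) * at s (suc j)) k)) (sym ∑-at-even) ⟩
      + totalSum y ℤ.+ expo a b k s ∎
      where
      open ≡-Reasoning
      squares-2sum : Vec ℕ k → ℤ
      squares-2sum v =
        + ∑[ i < k ] (at v (suc (toℕ i)) * at v (suc (toℕ i))) ℤ.- + (2 * ∑[ i < k ] at v (suc (toℕ i)))
      C P Q SA SB : ℕ
      C = ∑[ j < k ] (ℓ j * evenBound (suc (toℕ j)))
      P = ∑[ i < k ] (at s (suc (toℕ i)) * at s (suc (toℕ i)))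
      Q = ∑[ i < k ] at s (suc (toℕ i))
      SA = ∑[ j < k ] (ℓ j * aCount (suc (toℕ j)))
      SB = sumℕ (map (λ i → at s ((k + 2 * suc i) ∸ 2 * b)) (upTo b))

-- Counting the solutions

∈-decr⁺ : ∀ {k B} {s : Vec ℕ k} → NonIncreasing s → at s 1 ≤ B → s ∈ decr k B
∈-decr⁺ {zero} {s = []} _ _ = here refl
∈-decr⁺ {suc k} {s = x ∷ s} (s≤x , dec) x≤B =
  ∈-concatMap⁺ _ (lose (∈-upTo⁺ (s≤s x≤B)) (∈-map⁺ (x ∷_) (∈-decr⁺ dec s≤x)))

∈-decr⁻ : ∀ {k B} {s : Vec ℕ k} → s ∈ decr k B → NonIncreasing s × at s 1 ≤ B
∈-decr⁻ {zero} {s = []} _ = tt , z≤n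
∈-decr⁻ {suc k} {B} s∈
  with x , x∈ , s∈′ ← find (∈-concatMap⁻ (λ x → map (x ∷_) (decr k x)) {xs = upTo (suc B)} s∈)
  with s′ , s′∈ , refl ← ∈-map⁻ (x ∷_) s∈′
  with dec , s≤x ← ∈-decr⁻ s′∈
  = (s≤x , dec) , ℕ.s≤s⁻¹ (∈-upTo⁻ x∈)

Unique-decr : ∀ k B → Unique (decr k B)
Unique-decr zero B = [] ∷ []
Unique-decr (suc k) B = Unique-concatMap⁺ _ (Unique.upTo⁺ (suc B))
  (λ x → Unique.map⁺ (λ eq → proj₂ (Vec.∷-injective eq)) (Unique-decr k x)) same-head
  where
  same-head : ∀ {x x′ s} → x ∈ upTo (suc B) → x′ ∈ upTo (suc B) →
    s ∈ map (x ∷_) (decr k x) → s ∈ map (x′ ∷_) (decr k x′) → x ≡ x′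
  same-head _ _ p q with _ , _ , refl ← ∈-map⁻ _ p | _ , _ , refl ← ∈-map⁻ _ q = refl

enumAt : {A : Set} → ℤ → (ℕ → List A) → List A
enumAt (+ n) E = E n
enumAt -[1+ _ ] E = []

module _ {A : Set} (E : ℕ → List A) where

  shiftCoeff-enumAt : ∀ {F} e N → (∀ n → F n ≡ + length (E n)) →
    shiftCoeff e F N ≡ + length (enumAt (N ℤ.- e) E)
  shiftCoeff-enumAt e N F≡E with N ℤ.- e
  ... | + n = F≡E n
  ... | -[1+ _ ] = refl

  ∈-enumAt⁻ : ∀ {z x} → x ∈ enumAt z E → ∃[ n ] (z ≡ + n × x ∈ E n)
  ∈-enumAt⁻ {+ n} x∈ = n , refl , x∈

  Unique-enumAt : (∀ n → Unique (E n)) → ∀ z → Unique (enumAt z E)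
  Unique-enumAt uE (+ n) = uE n
  Unique-enumAt uE -[1+ _ ] = []

module Solutions (a b k : ℕ) (2a+2b≤1+k : 2 * a + 2 * b ≤ suc k) (N : ℤ) where
  open PartBounds a b k 2a+2b≤1+k
  open ShiftedWeight a b k 2a+2b≤1+k

  shiftedTuples : Vec ℕ k → ℕ → List (Vec (List ℕ) k)
  shiftedTuples s n = map (shift evenBound) (reducedTuples s n)

  ofShape : Vec ℕ k → List (Vec (List ℕ) k)
  ofShape s = enumAt (N ℤ.- expo a b k s) (shiftedTuples s)

  solutions : ℕ → List (Vec (List ℕ) k)
  solutions B = concatMap ofShape (decr k B)

  rhsTrunc-solutions : ∀ B → rhsTrunc a b k B N ≡ + length (solutions B)
  rhsTrunc-solutions B = begin
    sumℤ (map (λ s → shiftCoeff (expo a b k s) (denom k s) N) (decr k B))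
      ≡⟨ cong sumℤ (map-cong coefficient (decr k B)) ⟩
    sumℤ (map (+_ ∘ length ∘ ofShape) (decr k B))
      ≡⟨ sumℤ-map-+ (length ∘ ofShape) (decr k B) ⟩
    + sumℕ (map (length ∘ ofShape) (decr k B))
      ≡⟨ cong +_ (length-concatMap ofShape (decr k B)) ⟨
    + length (solutions B) ∎
    where
    open ≡-Reasoning
    coefficient : ∀ s → shiftCoeff (expo a b k s) (denom k s) N ≡ + length (ofShape s)
    coefficient s = shiftCoeff-enumAt (shiftedTuples s) (expo a b k s) N
      (λ n → trans (length-reducedTuples s n) (cong +_ (sym (length-map (shift evenBound) (reducedTuples s n)))))

  ∈-ofShape⁻ : ∀ {s x} → NonIncreasing s → x ∈ ofShape s → sVec x ≡ s × InX a b k x × pairWeight x ≡ N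
  ∈-ofShape⁻ {s} dec x∈
    with n , N-e≡n , x∈′ ← ∈-enumAt⁻ (shiftedTuples s) {N ℤ.- expo a b k s} x∈
    with y , y∈ , refl ← ∈-map⁻ (shift evenBound) x∈′
    with red , refl ← ∈-reducedTuples⁻ s y∈
    with refl ← sVec-Reduced dec red
    = sVec-shift evenBound y ,
      Equivalence.from (InX⇔evenBound {shift evenBound y}) (shift-Reduced evenBound-even red) ,
      (begin
        pairWeight (shift evenBound y)        ≡⟨ pairWeight-shift y ⟩
        + totalSum y ℤ.+ e                    ≡⟨ cong (ℤ._+ e) N-e≡n ⟨
        N ℤ.- e ℤ.+ e                         ≡⟨ minus-plus N e ⟩
        N ∎)
    where
    open ≡-Reasoning
    e = expo a b k (sVec y)
    minus-plus : ∀ N e → N ℤ.- e ℤ.+ e ≡ N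
    minus-plus = ℤ-Solver.solve-∀

  ∈-ofShape⁺ : ∀ {x} → InX a b k x → pairWeight x ≡ N → x ∈ ofShape (sVec x)
  ∈-ofShape⁺ {x} inX weight≡N = subst (_∈ ofShape (sVec x)) x≡
    (subst (λ z → shift evenBound y ∈ enumAt z (shiftedTuples (sVec x))) (sym N-e≡totalSum)
      (∈-map⁺ (shift evenBound) (∈-reducedTuples⁺ (sVec x) red)))
    where
    open ≡-Reasoning
    parts : AllEvenPartsFrom evenBound x
    parts = Equivalence.to (InX⇔evenBound {x}) inX
    y = unshift evenBound x
    x≡ : shift evenBound y ≡ x
    x≡ = shift-unshift evenBound parts
    red : Reduced (sVec x) y
    red = unshift-Reduced evenBound-even parts
    e = expo a b k (sVec x)
    N≡ : N ≡ + totalSum y ℤ.+ e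
    N≡ = begin
      N                                     ≡⟨ weight≡N ⟨
      pairWeight x                          ≡⟨ cong pairWeight x≡ ⟨
      pairWeight (shift evenBound y)        ≡⟨ pairWeight-shift y ⟩
      + totalSum y ℤ.+ expo a b k (sVec y)  ≡⟨ cong (λ v → + totalSum y ℤ.+ expo a b k v)
                                                     (sVec-Reduced (sVec-NonIncreasing x) red) ⟩
      + totalSum y ℤ.+ e ∎
    plus-minus : ∀ t e → t ℤ.+ e ℤ.- e ≡ t
    plus-minus = ℤ-Solver.solve-∀
    N-e≡totalSum : N ℤ.- e ≡ + totalSum y
    N-e≡totalSum = trans (cong (ℤ._- e) N≡) (plus-minus (+ totalSum y) e)

  sVec-∈-solutions : ∀ {B s x} → s ∈ decr k B → x ∈ ofShape s → sVec x ≡ s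
  sVec-∈-solutions s∈ x∈ = proj₁ (∈-ofShape⁻ (proj₁ (∈-decr⁻ s∈)) x∈)

  Unique-solutions : ∀ B → Unique (solutions B)
  Unique-solutions B = Unique-concatMap⁺ ofShape (Unique-decr k B)
    (λ s → Unique-enumAt (shiftedTuples s)
             (λ n → Unique.map⁺ (shift-injective evenBound) (Unique-reducedTuples s n)) (N ℤ.- expo a b k s))
    (λ s∈ s′∈ x∈ x∈′ → trans (sym (sVec-∈-solutions s∈ x∈)) (sVec-∈-solutions s′∈ x∈′))

  ∈-solutions : ∀ {B x} → ℤ.∣ N ∣ + 1 ≤ B → x ∈ solutions B ⇔ (InX a b k x × pairWeight x ≡ N)
  ∈-solutions {B} {x} bound≤B = mk⇔
    (λ x∈ → let s , s∈ , x∈s = find (∈-concatMap⁻ ofShape {xs = decr k B} x∈)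
            in proj₂ (∈-ofShape⁻ (proj₁ (∈-decr⁻ s∈)) x∈s))
    (λ (inX , weight≡N) → ∈-concatMap⁺ ofShape
      (lose (∈-decr⁺ (sVec-NonIncreasing x) (≤-trans (s₁≤ inX weight≡N) bound≤B)) (∈-ofShape⁺ inX weight≡N)))
    where
    s₁≤ : InX a b k x → pairWeight x ≡ N → at (sVec x) 1 ≤ ℤ.∣ N ∣ + 1
    s₁≤ inX refl = s₁-bound x (λ i → All.map (λ (_ , bound≤p) → ≤-trans (m≤partBound _) bound≤p) (proj₂ (inX i)))

proposition5p2 : (a b k : ℕ) → 2 * a + 2 * b ≤ suc k → (N : ℤ) →
    Σ (List (Vec (List ℕ) k)) λ L →
      Unique L ×
      ((x : Vec (List ℕ) k) → (x ∈ L) ⇔ (InX a b k x × pairWeight x ≡ N)) ×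
      ∃ λ B → (B′ : ℕ) → B ≤ B′ → rhsTrunc a b k B′ N ≡ + length L
proposition5p2 a b k 2a+2b≤1+k N =
  solutions B₀ , Unique-solutions B₀ , (λ _ → ∈-solutions ≤-refl) , B₀ , λ B′ B₀≤B′ → begin
    rhsTrunc a b k B′ N         ≡⟨ rhsTrunc-solutions B′ ⟩
    + length (solutions B′)     ≡⟨ cong +_ (unique-length (Unique-solutions B′) (Unique-solutions B₀)
                                     (⇔.trans (∈-solutions B₀≤B′) (⇔.sym (∈-solutions ≤-refl)))) ⟩
    + length (solutions B₀) ∎
  where
  open ≡-Reasoning
  open Solutions a b k 2a+2b≤1+k N
  B₀ = ℤ.∣ N ∣ + 1
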